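{- Let $n\ge 7$. Every elongated triangular prism graph $G$ with exactly $2n-3$ vertices satisfies that $K_n$ is a minor of $\overline{G}$.
   Context: The triangular prism graph has vertices $u_A,u_B,u_C,w_A,w_B,w_C$ and edges forming the two triangles $u_Au_Bu_C$ and $w_Aw_Bw_C$ together with the three edges $(u_A,w_A),(u_B,w_B),(u_C,w_C)$. An elongated triangular prism graph is any graph obtained from the triangular prism graph by subdividing (any number of times, possibly zero, independently for each) the edges $(u_A,w_A)$, $(u_B,w_B)$, $(u_C,w_C)$, i.e. replacing each of them by a path. The complement $\overline{G}$ has the same vertex set as $G$, with two distinct vertices adjacent iff they are not adjacent in $G$. Minors are obtained by vertex deletions, edge deletions and edge contractions. -}

module Defs where

open import Data.Nat using (ℕ; zero; suc)
open import Data.Fin using (Fin; toℕ)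
open import Data.Product using (Σ; ∃; _×_; _,_)
open import Data.Sum using (_⊎_)
open import Relation.Nullary using (¬_)
open import Relation.Binary.PropositionalEquality using (_≡_; _≢_)

Graph : Set → Set₁
Graph V = V → V → Set

Complement : {V : Set} → Graph V → Graph V
Complement G x y = (x ≢ y) × ¬ G x y

K : (n : ℕ) → Graph (Fin n)
K n i j = i ≢ j

data WalkIn {V : Set} (G : Graph V) (S : V → Set) : V → V → Set where
  here : ∀ {v} → S v → WalkIn G S v v
  step : ∀ {v v' v''} → S v → G v v' → WalkIn G S v' v'' → WalkIn G S v v''

-- This is equivalent to obtaining (a copy of)
-- H from G by vertex deletions, edge deletions and edge contractions.
record IsMinor {W V : Set} (H : Graph W) (G : Graph V) : Set₁ where
  field
    branch    : W → V → Set
    nonempty  : ∀ x → ∃ λ v → branch x v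
    disjoint  : ∀ x y v → branch x v → branch y v → x ≡ y
    connected : ∀ x v v' → branch x v → branch x v' → WalkIn G (branch x) v v'
    edges     : ∀ x y → H x y → ∃ λ v → ∃ λ v' → branch x v × branch y v' × G v v'

data Side : Set where
  A B C : Side

len : ℕ → ℕ → ℕ → Side → ℕ
len a b c A = a
len a b c B = b
len a b c C = c

-- Vertex set: u_X, w_X for X ∈ {A,B,C}, plus the internal vertices s X i
-- (i < len X) of the path replacing the edge (u_X , w_X).
-- Total number of vertices: 6 + a + b + c.
data PV (a b c : ℕ) : Set where
  u : Side → PV a b c
  w : Side → PV a b c
  s : (X : Side) → Fin (len a b c X) → PV a b c

data At {a b c : ℕ} (X : Side) : PV a b c → ℕ → Set where
  atU : At X (u X) 0
  atS : (i : Fin (len a b c X)) → At X (s X i) (suc (toℕ i))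
  atW : At X (w X) (suc (len a b c X))

data PrismAdj {a b c : ℕ} : PV a b c → PV a b c → Set where
  uu   : ∀ {X Y} → X ≢ Y → PrismAdj (u X) (u Y)
  ww   : ∀ {X Y} → X ≢ Y → PrismAdj (w X) (w Y)
  path : ∀ {X x y p q} → At X x p → At X y q → (suc p ≡ q ⊎ suc q ≡ p) → PrismAdj x y

-- The elongated triangular prism graph where the edges (u_A,w_A), (u_B,w_B),
-- (u_C,w_C) are subdivided a, b, c times respectively.
Prism : (a b c : ℕ) → Graph (PV a b c)
Prism a b c = PrismAdj

{-# OPTIONS --safe #-}

-- Induction on n, by adding two subdivision vertices to some path.  If they are inserted at
-- positions 1 and 3 of the path from u A, they are non-adjacent, so together they form a new
-- connected branch set in the complement; the vertex at position 1 is co-adjacent to every old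
-- vertex except u A and the old first inner vertex s A 0, and the vertex at position 3 is
-- co-adjacent to u A.  So the new branch set is adjacent to every old one, provided no old branch
-- set is contained in {s A 0}; since the sides are rotated, we keep the invariant that every branch
-- set has a vertex which is not the first inner vertex of any path.  The seven base cases n = 7
-- (one for each rotation class of (a, b, c) with a + b + c = 5) are explicit models, checked by
-- evaluation.
module Submission where

open import Defs
open import Data.Nat using (ℕ; zero; suc; _+_; _*_; _∸_; _≤_; _<_; _≤?_; s≤s)
open import Data.Nat.Properties
  using (+-assoc; +-comm; *-comm; +-mono-≤; m≤m+n; ≤-pred; ≰⇒>; <⇒≱; m≤n⇒∃[o]m+o≡n)
  renaming (_≟_ to _≟ℕ_)
open import Data.Fin using (Fin; zero; suc; toℕ; #_)
open import Data.Fin.Properties using () renaming (_≟_ to _≟ᶠ_; all? to allFin?)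
open import Data.Product using (∃; ∃₂; _×_; _,_)
open import Data.Sum using (_⊎_; inj₁; inj₂)
import Data.Sum as Sum
open import Data.Empty using (⊥; ⊥-elim)
open import Data.Unit using (⊤; tt)
open import Data.List using (List; []; _∷_)
open import Data.List.Relation.Unary.All using (All; all?)
import Data.List.Relation.Unary.All as All
open import Data.List.Relation.Unary.Any using (Any; any?; here; there)
open import Data.List.Membership.Propositional using (_∈_; _∉_; find)
open import Data.Vec using (Vec; _∷_; [])
import Data.Vec as Vec
open import Function using (_∘_)
open import Function.Definitions using (Injective)
open import Function.Consequences.Propositional using (inverseʳ⇒injective; strictlyInverseʳ⇒inverseʳ)
open import Relation.Binary.Definitions using (Symmetric; DecidableEquality)
open import Relation.Nullary using (¬_; Dec; yes; no)
open import Relation.Nullary.Decidable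
  using (map′; ¬?; _×-dec_; _⊎-dec_; _→-dec_; True; toWitness; decidable-stable)
open import Relation.Binary.PropositionalEquality
  using (_≡_; _≢_; refl; sym; trans; cong; subst; subst₂)

module _ {V V' : Set} (f : V → V') where

  Image : (V → Set) → V' → Set
  Image S v' = ∃ λ v → f v ≡ v' × S v

  walk-map : {G : Graph V} {G' : Graph V'} → (∀ {x y} → G x y → G' (f x) (f y)) →
             ∀ {S x y} → WalkIn G S x y → WalkIn G' (Image S) (f x) (f y)
  walk-map hom (here sx)        = here (_ , refl , sx)
  walk-map hom (step sx xy walk) = step (_ , refl , sx) (hom xy) (walk-map hom walk)

minor-map : ∀ {W V V'} {H : Graph W} {G : Graph V} {G' : Graph V'} (f : V → V') →
            Injective _≡_ _≡_ f → (∀ {x y} → G x y → G' (f x) (f y)) →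
            IsMinor H G → IsMinor H G'
minor-map f f-inj hom M = record
  { branch    = λ x → Image f (branch x)
  ; nonempty  = λ x → let v , xv = nonempty x in f v , v , refl , xv
  ; disjoint  = λ { x y _ (v , refl , xv) (v' , fv'≡fv , yv') →
                    disjoint x y v xv (subst (branch y) (f-inj fv'≡fv) yv') }
  ; connected = λ { x _ _ (v , refl , xv) (v' , refl , xv') →
                    walk-map f hom (connected x v v' xv xv') }
  ; edges     = λ x y xy → let v , v' , xv , yv' , vv' = edges x y xy in
                  f v , f v' , (v , refl , xv) , (v' , refl , yv') , hom vv'
  }
  where open IsMinor M

complement-map : ∀ {V V'} {G : Graph V} {G' : Graph V'} (f : V → V') →
                 Injective _≡_ _≡_ f → (∀ {x y} → G' (f x) (f y) → G x y) →
                 ∀ {x y} → Complement G x y → Complement G' (f x) (f y)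
complement-map f f-inj reflects (x≢y , ¬xy) = (x≢y ∘ f-inj) , (¬xy ∘ reflects)

complement-symmetric : ∀ {V} {G : Graph V} → Symmetric G → Symmetric (Complement G)
complement-symmetric G-sym (x≢y , ¬xy) = (x≢y ∘ sym) , (¬xy ∘ G-sym)

minor-extend : ∀ {V} {G : Graph V} {n} → Symmetric G → (M : IsMinor (K n) G) →
  (T : V → Set) → ∃ T → (∀ t t' → T t → T t' → WalkIn G T t t') →
  (∀ i v → IsMinor.branch M i v → ¬ T v) →
  (∀ i → ∃₂ λ v t → IsMinor.branch M i v × T t × G v t) →
  IsMinor (K (suc n)) G
minor-extend {V} {G} {n} G-sym M T T-nonempty T-connected T-new T-reached = record
  { branch = branch′ ; nonempty = nonempty′ ; disjoint = disjoint′
  ; connected = connected′ ; edges = edges′ }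
  where
  open IsMinor M

  branch′ : Fin (suc n) → V → Set
  branch′ zero    = T
  branch′ (suc i) = branch i

  nonempty′ : ∀ i → ∃ (branch′ i)
  nonempty′ zero    = T-nonempty
  nonempty′ (suc i) = nonempty i

  disjoint′ : ∀ i j v → branch′ i v → branch′ j v → i ≡ j
  disjoint′ zero    zero    _ _  _   = refl
  disjoint′ zero    (suc j) v tv jv  = ⊥-elim (T-new j v jv tv)
  disjoint′ (suc i) zero    v iv tv  = ⊥-elim (T-new i v iv tv)
  disjoint′ (suc i) (suc j) v iv jv  = cong suc (disjoint i j v iv jv)

  connected′ : ∀ i v v' → branch′ i v → branch′ i v' → WalkIn G (branch′ i) v v'
  connected′ zero    = T-connected
  connected′ (suc i) = connected i

  edges′ : ∀ i j → K (suc n) i j → ∃₂ λ v v' → branch′ i v × branch′ j v' × G v v'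
  edges′ zero    zero    i≢j = ⊥-elim (i≢j refl)
  edges′ zero    (suc j) _   = let v , t , jv , Tt , vt = T-reached j in t , v , Tt , jv , G-sym vt
  edges′ (suc i) zero    _   = T-reached i
  edges′ (suc i) (suc j) i≢j = edges i j (i≢j ∘ cong suc)

prism-symmetric : ∀ {a b c} → Symmetric (Prism a b c)
prism-symmetric (uu X≢Y)          = uu (X≢Y ∘ sym)
prism-symmetric (ww X≢Y)          = ww (X≢Y ∘ sym)
prism-symmetric (path ax ay steps) = path ay ax (Sum.swap steps)

data FirstInner {a b c : ℕ} : PV a b c → Set where
  first : ∀ X (i : Fin (len a b c X)) → toℕ i ≡ 0 → FirstInner (s X i)

record PrismModel (n a b c : ℕ) : Set₁ where
  field
    minor        : IsMinor (K n) (Complement (Prism a b c))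
    has-nonfirst : ∀ i → ∃ λ v → IsMinor.branch minor i v × ¬ FirstInner v

open PrismModel

model-map : ∀ {n a b c a' b' c'} (f : PV a b c → PV a' b' c') → Injective _≡_ _≡_ f →
  (∀ {x y} → Prism a' b' c' (f x) (f y) → Prism a b c x y) →
  (∀ {x} → FirstInner (f x) → FirstInner x) →
  PrismModel n a b c → PrismModel n a' b' c'
model-map {a = a} {b} {c} {a'} {b'} {c'} f f-inj reflects first-reflects P = record
  { minor        = minor-map f f-inj
                     (complement-map {G = Prism a b c} {G' = Prism a' b' c'} f f-inj reflects) (minor P)
  ; has-nonfirst = λ i → let v , iv , nf = has-nonfirst P i in
                     f v , (v , refl , iv) , nf ∘ first-reflects
  }

-- Rotating the sides A → B → C → A

next : Side → Side
next A = B
next B = C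
next C = A

next³ : ∀ X → next (next (next X)) ≡ X
next³ A = refl
next³ B = refl
next³ C = refl

next-injective : ∀ {X Y} → next X ≡ next Y → X ≡ Y
next-injective {X} {Y} e = trans (sym (next³ X)) (trans (cong (next ∘ next) e) (next³ Y))

module _ {a b c : ℕ} where

  rotate-vertex : PV a b c → PV c a b
  rotate-vertex (u X)   = u (next X)
  rotate-vertex (w X)   = w (next X)
  rotate-vertex (s A i) = s B i
  rotate-vertex (s B i) = s C i
  rotate-vertex (s C i) = s A i

  rotate-at : ∀ {X x p} → At X x p → At (next X) (rotate-vertex x) p
  rotate-at atU         = atU
  rotate-at {A} (atS i) = atS i
  rotate-at {B} (atS i) = atS i
  rotate-at {C} (atS i) = atS i
  rotate-at {A} atW     = atW
  rotate-at {B} atW     = atW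
  rotate-at {C} atW     = atW

  rotate-first : ∀ {x} → FirstInner (rotate-vertex x) → FirstInner x
  rotate-first {s A i} (first _ _ i≡0) = first A i i≡0
  rotate-first {s B i} (first _ _ i≡0) = first B i i≡0
  rotate-first {s C i} (first _ _ i≡0) = first C i i≡0

rotate-adjacent : ∀ {a b c} {x y : PV a b c} →
                  Prism a b c x y → Prism c a b (rotate-vertex x) (rotate-vertex y)
rotate-adjacent (uu X≢Y)          = uu (X≢Y ∘ next-injective)
rotate-adjacent (ww X≢Y)          = ww (X≢Y ∘ next-injective)
rotate-adjacent (path ax ay steps) = path (rotate-at ax) (rotate-at ay) steps

rotate³ : ∀ {a b c} (x : PV a b c) → rotate-vertex (rotate-vertex (rotate-vertex x)) ≡ x
rotate³ (u A)   = refl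
rotate³ (u B)   = refl
rotate³ (u C)   = refl
rotate³ (w A)   = refl
rotate³ (w B)   = refl
rotate³ (w C)   = refl
rotate³ (s A i) = refl
rotate³ (s B i) = refl
rotate³ (s C i) = refl

rotate : ∀ {n a b c} → PrismModel n a b c → PrismModel n c a b
rotate = model-map rotate-vertex rotate-injective rotate-reflects rotate-first
  where
  rotate-injective : ∀ {a b c} → Injective _≡_ _≡_ (rotate-vertex {a} {b} {c})
  rotate-injective = inverseʳ⇒injective rotate-vertex
    (strictlyInverseʳ⇒inverseʳ {f⁻¹ = rotate-vertex ∘ rotate-vertex} rotate-vertex rotate³)
  rotate-reflects : ∀ {a b c} {x y : PV a b c} →
                    Prism c a b (rotate-vertex x) (rotate-vertex y) → Prism a b c x y
  rotate-reflects {x = x} {y} xy =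
    subst₂ PrismAdj (rotate³ x) (rotate³ y) (rotate-adjacent (rotate-adjacent xy))

-- Lengthening path A by two vertices

module Lengthen {a b c : ℕ} where

  shift : Fin (suc a) → Fin (3 + a)
  shift zero    = suc zero
  shift (suc k) = suc (suc (suc k))

  embed : PV (suc a) b c → PV (3 + a) b c
  embed (u X)   = u X
  embed (w X)   = w X
  embed (s A i) = s A (shift i)
  embed (s B i) = s B i
  embed (s C i) = s C i

  retract : PV (3 + a) b c → PV (suc a) b c
  retract (u X)                     = u X
  retract (w X)                     = w X
  retract (s A zero)                = u A
  retract (s A (suc zero))          = s A zero
  retract (s A (suc (suc zero)))    = u A
  retract (s A (suc (suc (suc k)))) = s A (suc k)
  retract (s B i)                   = s B i
  retract (s C i)                   = s C i

  retract-embed : ∀ x → retract (embed x) ≡ x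
  retract-embed (u X)         = refl
  retract-embed (w X)         = refl
  retract-embed (s A zero)    = refl
  retract-embed (s A (suc k)) = refl
  retract-embed (s B i)       = refl
  retract-embed (s C i)       = refl

  embed-injective : Injective _≡_ _≡_ embed
  embed-injective =
    inverseʳ⇒injective embed (strictlyInverseʳ⇒inverseʳ {f⁻¹ = retract} embed retract-embed)

  stretch : Side → ℕ → ℕ
  stretch A zero          = zero
  stretch A (suc zero)    = 2
  stretch A (suc (suc p)) = 4 + p
  stretch B p = p
  stretch C p = p

  stretch-zero : ∀ X → stretch X 0 ≡ 0
  stretch-zero A = refl
  stretch-zero B = refl
  stretch-zero C = refl

  stretch-reflects-suc : ∀ X p q → suc (stretch X p) ≡ stretch X q → suc p ≡ q
  stretch-reflects-suc A zero          (suc zero)    ()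
  stretch-reflects-suc A zero          (suc (suc _)) ()
  stretch-reflects-suc A (suc zero)    (suc zero)    ()
  stretch-reflects-suc A (suc zero)    (suc (suc _)) ()
  stretch-reflects-suc A (suc (suc p)) (suc (suc q)) refl = refl
  stretch-reflects-suc B p q e = e
  stretch-reflects-suc C p q e = e

  embed-at : ∀ {X x p} → At X (embed x) p → ∃ λ p' → At X x p' × p ≡ stretch X p'
  embed-at {x = u X}         atU     = 0 , atU , sym (stretch-zero X)
  embed-at {x = w A}         atW     = _ , atW , refl
  embed-at {x = w B}         atW     = _ , atW , refl
  embed-at {x = w C}         atW     = _ , atW , refl
  embed-at {x = s A zero}    (atS _) = _ , atS zero , refl
  embed-at {x = s A (suc k)} (atS _) = _ , atS (suc k) , refl
  embed-at {x = s B i}       (atS _) = _ , atS i , refl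
  embed-at {x = s C i}       (atS _) = _ , atS i , refl

  embed-reflects : ∀ {x y} → Prism (3 + a) b c (embed x) (embed y) → Prism (suc a) b c x y
  embed-reflects {x} {y} xy = reflect xy refl refl
    where
    reflect : ∀ {x' y'} → PrismAdj x' y' → embed x ≡ x' → embed y ≡ y' → PrismAdj x y
    reflect (uu X≢Y) ex ey =
      subst₂ PrismAdj (sym (embed-injective {x} {u _} ex)) (sym (embed-injective {y} {u _} ey)) (uu X≢Y)
    reflect (ww X≢Y) ex ey =
      subst₂ PrismAdj (sym (embed-injective {x} {w _} ex)) (sym (embed-injective {y} {w _} ey)) (ww X≢Y)
    reflect (path {X} ax ay steps) refl refl with embed-at ax | embed-at ay
    ... | p , ax' , refl | q , ay' , refl =
      path ax' ay' (Sum.map (stretch-reflects-suc X p q) (stretch-reflects-suc X q p) steps)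

  embed-first : ∀ {x} → FirstInner (embed x) → FirstInner x
  embed-first {s A zero}    (first _ _ ())
  embed-first {s A (suc k)} (first _ _ ())
  embed-first {s B i}       (first _ _ i≡0) = first B i i≡0
  embed-first {s C i}       (first _ _ i≡0) = first C i i≡0

  Co : Graph (PV (3 + a) b c)
  Co = Complement (Prism (3 + a) b c)

  co-symmetric : Symmetric Co
  co-symmetric = complement-symmetric prism-symmetric

  v₁ v₃ : PV (3 + a) b c
  v₁ = s A zero
  v₃ = s A (suc (suc zero))

  data New : PV (3 + a) b c → Set where
    new₁ : New v₁
    new₃ : New v₃

  embed-old : ∀ v → ¬ New (embed v)
  embed-old (u _)         ()
  embed-old (w _)         ()
  embed-old (s A zero)    ()
  embed-old (s A (suc _)) ()
  embed-old (s B _)       ()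
  embed-old (s C _)       ()

  v₁-neighbours : ∀ {z} → PrismAdj z v₁ → z ≡ u A ⊎ z ≡ embed (s A zero)
  v₁-neighbours (path atU                 (atS _) _)        = inj₁ refl
  v₁-neighbours (path (atS zero)          (atS _) (inj₁ ()))
  v₁-neighbours (path (atS zero)          (atS _) (inj₂ ()))
  v₁-neighbours (path (atS (suc zero))    (atS _) _)        = inj₂ refl
  v₁-neighbours (path (atS (suc (suc _))) (atS _) (inj₁ ()))
  v₁-neighbours (path atW                 (atS _) (inj₁ ()))

  v₁-co : ∀ z → z ≢ v₁ → z ≢ u A → z ≢ embed (s A zero) → Co z v₁
  v₁-co z z≢v₁ z≢u z≢s = z≢v₁ , Sum.[ z≢u , z≢s ] ∘ v₁-neighbours

  u-v₃-co : Co (u A) v₃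
  u-v₃-co = (λ ()) , λ { (path atU (atS _) (inj₁ ())) ; (path atU (atS _) (inj₂ ())) }

  v₃-v₁-co : Co v₃ v₁
  v₃-v₁-co = v₁-co v₃ (λ ()) (λ ()) (λ ())

  new-connected : ∀ t t' → New t → New t' → WalkIn Co New t t'
  new-connected _ _ new₁ new₁ = here new₁
  new-connected _ _ new₁ new₃ = step new₁ (co-symmetric v₃-v₁-co) (here new₃)
  new-connected _ _ new₃ new₁ = step new₃ v₃-v₁-co (here new₁)
  new-connected _ _ new₃ new₃ = here new₃

  new-neighbour : ∀ v → ¬ FirstInner v → ∃ λ t → New t × Co (embed v) t
  new-neighbour (u A)         _  = v₃ , new₃ , u-v₃-co
  new-neighbour (u B)         _  = v₁ , new₁ , v₁-co _ (λ ()) (λ ()) (λ ())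
  new-neighbour (u C)         _  = v₁ , new₁ , v₁-co _ (λ ()) (λ ()) (λ ())
  new-neighbour (w _)         _  = v₁ , new₁ , v₁-co _ (λ ()) (λ ()) (λ ())
  new-neighbour (s A zero)    nf = ⊥-elim (nf (first A zero refl))
  new-neighbour (s A (suc _)) _  = v₁ , new₁ , v₁-co _ (λ ()) (λ ()) (λ ())
  new-neighbour (s B _)       _  = v₁ , new₁ , v₁-co _ (λ ()) (λ ()) (λ ())
  new-neighbour (s C _)       _  = v₁ , new₁ , v₁-co _ (λ ()) (λ ()) (λ ())

  lengthen : ∀ {n} → PrismModel n (suc a) b c → PrismModel (suc n) (3 + a) b c
  lengthen P = record
    { minor = minor-extend co-symmetric (minor P′)
                New (v₁ , new₁) new-connected disjoint-new reaches-new
    ; has-nonfirst = λ { zero → v₃ , new₃ , (λ { (first _ _ ()) }) ; (suc i) → has-nonfirst P′ i }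
    }
    where
    P′ = model-map embed embed-injective embed-reflects embed-first P

    disjoint-new : ∀ i v → IsMinor.branch (minor P′) i v → ¬ New v
    disjoint-new i _ (v , refl , _) = embed-old v

    reaches-new : ∀ i → ∃₂ λ v t → IsMinor.branch (minor P′) i v × New t × Co v t
    reaches-new i = let v , iv , nf = has-nonfirst P i ; t , new , co = new-neighbour v nf in
                    embed v , t , (v , refl , iv) , new , co

open Lengthen using (lengthen)

-- Checking explicit models by evaluation

_≟ˢ_ : DecidableEquality Side
A ≟ˢ A = yes refl
B ≟ˢ B = yes refl
C ≟ˢ C = yes refl
A ≟ˢ B = no λ ()
A ≟ˢ C = no λ ()
B ≟ˢ A = no λ ()
B ≟ˢ C = no λ ()
C ≟ˢ A = no λ ()
C ≟ˢ B = no λ ()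

data BranchSet (V : Set) : Set where
  single : V → BranchSet V
  pair   : V → V → BranchSet V

members : ∀ {V} → BranchSet V → List V
members (single v)  = v ∷ []
members (pair v v') = v ∷ v' ∷ []

module _ {a b c : ℕ} where

  _≟ᵛ_ : DecidableEquality (PV a b c)
  u X ≟ᵛ u Y = map′ (cong u) (λ { refl → refl }) (X ≟ˢ Y)
  w X ≟ᵛ w Y = map′ (cong w) (λ { refl → refl }) (X ≟ˢ Y)
  s X i ≟ᵛ s Y j with X ≟ˢ Y
  ... | yes refl = map′ (cong (s X)) (λ { refl → refl }) (i ≟ᶠ j)
  ... | no X≢Y   = no λ { refl → X≢Y refl }
  u _   ≟ᵛ w _   = no λ ()
  u _   ≟ᵛ s _ _ = no λ ()
  w _   ≟ᵛ u _   = no λ ()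
  w _   ≟ᵛ s _ _ = no λ ()
  s _ _ ≟ᵛ u _   = no λ ()
  s _ _ ≟ᵛ w _   = no λ ()

  firstInner? : (v : PV a b c) → Dec (FirstInner v)
  firstInner? (u _)   = no λ ()
  firstInner? (w _)   = no λ ()
  firstInner? (s X i) = map′ (first X i) (λ { (first _ _ i≡0) → i≡0 }) (toℕ i ≟ℕ 0)

  side : PV a b c → Side
  side (u X)   = X
  side (w X)   = X
  side (s X _) = X

  position : PV a b c → ℕ
  position (u _)   = 0
  position (w X)   = suc (len a b c X)
  position (s _ i) = suc (toℕ i)

  at-position : ∀ {X x p} → At X x p → side x ≡ X × position x ≡ p
  at-position atU     = refl , refl
  at-position (atS _) = refl , refl
  at-position atW     = refl , refl

  SameEnd : PV a b c → PV a b c → Set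
  SameEnd (u _) (u _) = ⊤
  SameEnd (w _) (w _) = ⊤
  SameEnd _     _     = ⊥

  sameEnd? : ∀ x y → Dec (SameEnd x y)
  sameEnd? (u _)   (u _)   = yes tt
  sameEnd? (w _)   (w _)   = yes tt
  sameEnd? (u _)   (w _)   = no λ ()
  sameEnd? (u _)   (s _ _) = no λ ()
  sameEnd? (w _)   (u _)   = no λ ()
  sameEnd? (w _)   (s _ _) = no λ ()
  sameEnd? (s _ _) _       = no λ ()

  -- A decidable over-approximation of adjacency: it ignores that two corners must be distinct.
  Near : PV a b c → PV a b c → Set
  Near x y = SameEnd x y ⊎
             side x ≡ side y × (suc (position x) ≡ position y ⊎ suc (position y) ≡ position x)

  near? : ∀ x y → Dec (Near x y)
  near? x y = sameEnd? x y ⊎-dec (side x ≟ˢ side y ×-dec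
                (suc (position x) ≟ℕ position y ⊎-dec suc (position y) ≟ℕ position x))

  adjacent⇒near : ∀ {x y} → Prism a b c x y → Near x y
  adjacent⇒near (uu _) = inj₁ tt
  adjacent⇒near (ww _) = inj₁ tt
  adjacent⇒near (path ax ay steps) =
    let sx , px = at-position ax ; sy , py = at-position ay in
    inj₂ (trans sx (sym sy) , subst₂ (λ p q → suc p ≡ q ⊎ suc q ≡ p) (sym px) (sym py) steps)

  Separated : PV a b c → PV a b c → Set
  Separated x y = x ≢ y × ¬ Near x y

  separated? : ∀ x y → Dec (Separated x y)
  separated? x y = ¬? (x ≟ᵛ y) ×-dec ¬? (near? x y)

  separated⇒co : ∀ {x y} → Separated x y → Complement (Prism a b c) x y
  separated⇒co (x≢y , ¬near) = x≢y , ¬near ∘ adjacent⇒near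

  Linked : BranchSet (PV a b c) → Set
  Linked (single _)  = ⊤
  Linked (pair v v') = Separated v v'

  linked? : ∀ B → Dec (Linked B)
  linked? (single _)  = yes tt
  linked? (pair v v') = separated? v v'

  linked-walk : ∀ B → Linked B → ∀ v v' → v ∈ members B → v' ∈ members B →
                WalkIn (Complement (Prism a b c)) (_∈ members B) v v'
  linked-walk (single _) _   _ _ (here refl)         (here refl)         = here (here refl)
  linked-walk (pair _ _) _   _ _ (here refl)         (here refl)         = here (here refl)
  linked-walk (pair _ _) _   _ _ (there (here refl)) (there (here refl)) = here (there (here refl))
  linked-walk (pair _ _) vv' _ _ (here refl)         (there (here refl)) =
    step (here refl) (separated⇒co vv') (here (there (here refl)))
  linked-walk (pair _ _) vv' _ _ (there (here refl)) (here refl)         =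
    step (there (here refl)) (complement-symmetric prism-symmetric (separated⇒co vv')) (here (here refl))

  record Certificate {n : ℕ} (bs : Fin n → BranchSet (PV a b c)) : Set where
    field
      linked   : ∀ i → Linked (bs i)
      nonfirst : ∀ i → Any (¬_ ∘ FirstInner) (members (bs i))
      apart    : ∀ i j → i ≢ j → All (_∉ members (bs j)) (members (bs i))
      touching : ∀ i j → i ≢ j → Any (λ v → Any (Separated v) (members (bs j))) (members (bs i))

  certificate? : ∀ {n} (bs : Fin n → BranchSet (PV a b c)) → Dec (Certificate bs)
  certificate? bs =
    map′ (λ (l , f , p , t) → record { linked = l ; nonfirst = f ; apart = p ; touching = t })
         (λ cert → let open Certificate cert in linked , nonfirst , apart , touching)
    ( allFin? (linked? ∘ bs)
    ×-dec allFin? (λ i → any? (¬? ∘ firstInner?) (members (bs i)))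
    ×-dec allFin? (λ i → allFin? λ j → ¬? (i ≟ᶠ j) →-dec
                    all? (λ v → ¬? (v ∈? members (bs j))) (members (bs i)))
    ×-dec allFin? (λ i → allFin? λ j → ¬? (i ≟ᶠ j) →-dec
                    any? (λ v → any? (separated? v) (members (bs j))) (members (bs i))) )
    where open import Data.List.Membership.DecPropositional _≟ᵛ_ using (_∈?_)

  certified-model : ∀ {n} (bs : Fin n → BranchSet (PV a b c)) → Certificate bs → PrismModel n a b c
  certified-model bs cert = record
    { minor = record
      { branch    = λ i v → v ∈ members (bs i)
      ; nonempty  = λ i → nonempty (bs i)
      ; disjoint  = λ i j v iv jv → decidable-stable (i ≟ᶠ j) λ i≢j → All.lookup (apart i j i≢j) iv jv
      ; connected = λ i → linked-walk (bs i) (linked i)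
      ; edges     = λ i j i≢j → let v , iv , touch = find (touching i j i≢j)
                                    v' , jv' , vv' = find touch
                                in v , v' , iv , jv' , separated⇒co vv'
      }
    ; has-nonfirst = find ∘ nonfirst
    }
    where
    open Certificate cert
    nonempty : ∀ B → ∃ (_∈ members B)
    nonempty (single v) = v , here refl
    nonempty (pair v _) = v , here refl

  certified : ∀ {n} (bs : Vec (BranchSet (PV a b c)) n) →
              {True (certificate? (Vec.lookup bs))} → PrismModel n a b c
  certified bs {valid} = certified-model (Vec.lookup bs) (toWitness valid)

model-500 : PrismModel 7 5 0 0
model-500 = certified
  ( single (s A (# 4))
  ∷ single (u C)
  ∷ single (s A (# 1))
  ∷ pair (w C) (s A (# 2))
  ∷ pair (s A (# 3)) (u A)
  ∷ pair (w B) (s A (# 0))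
  ∷ pair (w A) (u B)
  ∷ [] )

model-410 : PrismModel 7 4 1 0
model-410 = certified
  ( single (w B)
  ∷ single (s A (# 3))
  ∷ single (u C)
  ∷ pair (u B) (s A (# 0))
  ∷ pair (s A (# 1)) (w A)
  ∷ pair (s B (# 0)) (u A)
  ∷ pair (w C) (s A (# 2))
  ∷ [] )

model-401 : PrismModel 7 4 0 1
model-401 = certified
  ( single (w C)
  ∷ single (u C)
  ∷ single (s A (# 2))
  ∷ pair (s A (# 0)) (u B)
  ∷ pair (w B) (s A (# 3))
  ∷ pair (w A) (u A)
  ∷ pair (s C (# 0)) (s A (# 1))
  ∷ [] )

model-320 : PrismModel 7 3 2 0
model-320 = certified
  ( single (s A (# 1))
  ∷ single (u A)
  ∷ single (w C)
  ∷ pair (w A) (u B)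
  ∷ pair (s B (# 0)) (u C)
  ∷ pair (s A (# 2)) (s B (# 1))
  ∷ pair (s A (# 0)) (w B)
  ∷ [] )

model-302 : PrismModel 7 3 0 2
model-302 = certified
  ( single (s A (# 2))
  ∷ single (w C)
  ∷ single (u A)
  ∷ pair (u C) (w A)
  ∷ pair (w B) (s C (# 0))
  ∷ pair (s C (# 1)) (s A (# 0))
  ∷ pair (u B) (s A (# 1))
  ∷ [] )

model-311 : PrismModel 7 3 1 1
model-311 = certified
  ( single (w B)
  ∷ single (u A)
  ∷ single (s A (# 1))
  ∷ pair (s B (# 0)) (s A (# 2))
  ∷ pair (w C) (u C)
  ∷ pair (s C (# 0)) (u B)
  ∷ pair (s A (# 0)) (w A)
  ∷ [] )

model-221 : PrismModel 7 2 2 1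
model-221 = certified
  ( single (u A)
  ∷ single (s B (# 1))
  ∷ single (w A)
  ∷ pair (w B) (s A (# 0))
  ∷ pair (w C) (u C)
  ∷ pair (u B) (s C (# 0))
  ∷ pair (s B (# 0)) (s A (# 1))
  ∷ [] )

base : ∀ a b c → a + b + c ≡ 5 → PrismModel 7 a b c
base 5 0 0 refl = model-500
base 0 5 0 refl = rotate model-500
base 0 0 5 refl = rotate (rotate model-500)
base 4 1 0 refl = model-410
base 0 4 1 refl = rotate model-410
base 1 0 4 refl = rotate (rotate model-410)
base 4 0 1 refl = model-401
base 1 4 0 refl = rotate model-401
base 0 1 4 refl = rotate (rotate model-401)
base 3 2 0 refl = model-320
base 0 3 2 refl = rotate model-320
base 2 0 3 refl = rotate (rotate model-320)
base 3 0 2 refl = model-302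
base 2 3 0 refl = rotate model-302
base 0 2 3 refl = rotate (rotate model-302)
base 3 1 1 refl = model-311
base 1 3 1 refl = rotate model-311
base 1 1 3 refl = rotate (rotate model-311)
base 2 2 1 refl = model-221
base 1 2 2 refl = rotate model-221
base 2 1 2 refl = rotate (rotate model-221)

data LongSide : ℕ → ℕ → ℕ → Set where
  long-A : ∀ a {b c} → LongSide (3 + a) b c
  long-B : ∀ b {a c} → LongSide a (3 + b) c
  long-C : ∀ c {a b} → LongSide a b (3 + c)

long-side : ∀ a b c → 6 < a + b + c → LongSide a b c
long-side a b c h with 3 ≤? a | 3 ≤? b | 3 ≤? c
... | yes (s≤s (s≤s (s≤s _))) | _                         | _                         = long-A _
... | no _                       | yes (s≤s (s≤s (s≤s _))) | _                         = long-B _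
... | no _                       | no _                       | yes (s≤s (s≤s (s≤s _))) = long-C _
... | no a≱3 | no b≱3 | no c≱3 =
  ⊥-elim (<⇒≱ h (+-mono-≤ (+-mono-≤ (short a≱3) (short b≱3)) (short c≱3)))
  where
  short : ∀ {x} → ¬ 3 ≤ x → x ≤ 2
  short = ≤-pred ∘ ≰⇒>

sum-rotate : ∀ x y z → x + y + z ≡ z + x + y
sum-rotate x y z = trans (+-comm (x + y) z) (sym (+-assoc z x y))

-- (3 + x) + y + z computes to 2 + ((1 + x) + y + z), so cong (_∸ 2) removes the two new vertices.
grow : ∀ {k} → (∀ a b c → a + b + c ≡ 5 + k * 2 → PrismModel (7 + k) a b c) →
       ∀ a b c → a + b + c ≡ 7 + k * 2 → PrismModel (8 + k) a b c
grow {k} models a b c e with long-side a b c (subst (6 <_) (sym e) (m≤m+n 7 (k * 2)))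
... | long-A a' = lengthen (models (suc a') b c (cong (_∸ 2) e))
... | long-B b' = rotate (lengthen (models (suc b') c a
                    (cong (_∸ 2) (trans (sum-rotate (3 + b') c a) e))))
... | long-C c' = rotate (rotate (lengthen (models (suc c') a b
                    (cong (_∸ 2) (trans (sum-rotate (3 + c') a b) (trans (sum-rotate b (3 + c') a) e))))))

models : ∀ k a b c → a + b + c ≡ 5 + k * 2 → PrismModel (7 + k) a b c
models zero    = base
models (suc k) = grow (models k)

theorem8 : (n : ℕ) → 7 ≤ n → (a b c : ℕ) → 6 + a + b + c ≡ 2 * n ∸ 3 →
    IsMinor (K n) (Complement (Prism a b c))
theorem8 n 7≤n a b c e with m≤n⇒∃[o]m+o≡n 7≤n
... | k , refl = minor (models k a b c (cong (_∸ 6) (trans e (cong (_∸ 3) (*-comm 2 (7 + k))))))
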